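{- Let $\vec G$ be any feasible PV graph (anonymous or with ids, homogeneous or heterogeneous, with arbitrary routes) with system period $p$, and suppose the agent is given an integer $B\ge p$ (and no knowledge of $n$ or $k$). Then Algorithm Hitch-a-ride, executed from any starting site, visits every site of $\vec G$ and halts after finitely many moves.
   Context: A PV system consists of a finite set $S$ of $n$ sites and a set $C$ of $k$ carriers; each carrier $c$ has a unique identifier and a route $\pi(c)=\langle x_0,\dots,x_{p(c)-1}\rangle$ of sites, with period $p(c)$ and $\pi(c)[j]=x_{j\bmod p(c)}$; at each time $t=0,1,\dots$ carrier $c$ moves from $\pi(c)[t]$ to $\pi(c)[t+1]$. The system period is $p=\max_c p(c)$; the system is homogeneous if all periods are equal. Carriers $a,b$ meet at site $z$ at time $t$ if $\pi(a)[t]=\pi(b)[t]=z$. An exploring agent is placed at time $0$ at a starting site $x\in\{\pi(c)[0]\}$; at each time $t$, at site $y$, it observes the identifiers of carriers $c$ with $\pi(c)[t]=y$ and either halts or moves with one such carrier to $\pi(c)[t+1]$ (one move); "riding with $c$" means repeatedly choosing $c$, and the agent may switch from $c$ to $c'$ at a time when they meet. The PV graph is feasible if from every starting site some finite sequence of moves visits all sites. Algorithm Hitch-a-ride: let $B'=B$ if the agent is told the system is homogeneous and $B'=B^2$ otherwise. The agent starts riding with a carrier $c_0$ present at its start site (the Home, with no parent), keeps a set Visited of carriers (initially empty) and a set Encounters of carriers seen but not yet visited (initially $\{c_0\}$), and performs a depth-first (pre-order) traversal of the carriers as follows. When riding with a carrier $c\notin$ Visited, it visits $c$: it sets $N(c)=\{\mathrm{parent}(c)\}$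 and rides with $c$ for $B'$ time units, adding every carrier met during this ride that is neither visited nor in Encounters to Encounters and to $N(c)$; then it adds $c$ to Visited and removes $c$ from Encounters. Next, if $N(c)\cap$ Encounters $\neq\emptyset$, it keeps riding with $c$ until it meets some $c'\in N(c)\cap$ Encounters, sets $\mathrm{parent}(c')=c$, switches to $c'$ and continues with $c'$. Otherwise, if $c$ is the Home (and Encounters is empty) it halts; else it keeps riding with $c$ until it meets $\mathrm{parent}(c)$, switches to it and continues with it (visiting only carriers not yet in Visited). -}

module Defs where

open import Data.Nat using (ℕ; zero; suc; _≤_; _⊔_; _*_)
open import Data.Nat.DivMod using (_mod_)
open import Data.Fin using (Fin; _≟_)
open import Data.Fin.Base using (toℕ)
open import Data.List using (List; []; _∷_; map; foldr; allFin)
open import Data.List.Membership.Propositional using (_∈_)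
open import Data.Bool using (Bool; true; false; _∨_; _∧_; not; if_then_else_)
open import Data.Maybe using (Maybe; just; nothing)
open import Data.Product using (Σ; _×_; ∃; ∃-syntax)
open import Data.Unit using (⊤)
open import Data.Sum using (_⊎_)
open import Relation.Binary.PropositionalEquality using (_≡_)
open import Relation.Nullary using (¬_)
open import Relation.Nullary.Decidable using (⌊_⌋)

-- PV systems: n sites (Fin n), k carriers with identifiers (Fin k).
-- Carrier c has period  period c = suc (predPeriod c) ≥ 1  and route
-- ⟨x_0, …, x_{p(c)-1}⟩ given by  route c : Fin (period c) → Fin n.

record PV (n k : ℕ) : Set where
  field
    predPeriod : Fin k → ℕ
    route      : (c : Fin k) → Fin (suc (predPeriod c)) → Fin n

  period : Fin k → ℕ
  period c = suc (predPeriod c)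

  π : Fin k → ℕ → Fin n
  π c t = route c (t mod period c)

  sysPeriod : ℕ
  sysPeriod = foldr _⊔_ 0 (map period (allFin k))

  Homogeneous : Set
  Homogeneous = ∀ c d → period c ≡ period d

  -- A finite sequence of moves (carriers taken at times t, t+1, …)
  -- that is valid for an agent located at site x at time t.
  ValidMoves : ℕ → Fin n → List (Fin k) → Set
  ValidMoves t x []       = ⊤
  ValidMoves t x (c ∷ cs) = (π c t ≡ x) × ValidMoves (suc t) (π c (suc t)) cs

  visitedSites : ℕ → Fin n → List (Fin k) → List (Fin n)
  visitedSites t x []       = x ∷ []
  visitedSites t x (c ∷ cs) = x ∷ visitedSites (suc t) (π c (suc t)) cs

  -- feasibility: from every starting site (a site π(c)[0]) some finite
  -- sequence of moves visits all sites
  Feasible : Set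
  Feasible = ∀ (x : Fin n) → (∃[ c ] π c 0 ≡ x) →
             ∃[ cs ] (ValidMoves 0 x cs × (∀ y → y ∈ visitedSites 0 x cs))

-- Algorithm Hitch-a-ride, as a (nondeterministic) transition relation.
-- B' is the ride length (B if told homogeneous, B² otherwise).

data Phase : Set where
  visiting : ℕ → Phase   -- visiting the current carrier; remaining ride time
  leaving  : Phase       -- visit finished: look for next carrier / parent
  halted   : Phase

module HitchARide {n k : ℕ} (G : PV n k) (B' : ℕ) where
  open PV G

  record State : Set where
    field
      time  : ℕ
      car   : Fin k
      vis   : Fin k → Bool
      enc   : Fin k → Bool
      par   : Fin k → Maybe (Fin k)
      nb    : Fin k → Fin k → Bool
      phase : Phase
  open State public

  pos : State → Fin n
  pos s = π (car s) (time s)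

  here : State → Fin k → Bool
  here s d = ⌊ π d (time s) ≟ pos s ⌋

  eqF : Fin k → Fin k → Bool
  eqF a b = ⌊ a ≟ b ⌋

  cand : State → Fin k → Bool
  cand s d = nb s (car s) d ∧ enc s d

  data Step (s : State) : State → Set where
    visit-ride : ∀ r → phase s ≡ visiting (suc r) →
      Step s record s
        { time  = suc (time s)
        ; enc   = λ d → enc s d ∨ (here s d ∧ not (vis s d) ∧ not (enc s d))
        ; nb    = λ e d → if eqF e (car s)
                            then nb s e d ∨ (here s d ∧ not (vis s d) ∧ not (enc s d))
                            else nb s e d
        ; phase = visiting r }
    visit-done : phase s ≡ visiting 0 →
      Step s record s
        { vis   = λ d → if eqF d (car s) then true  else vis s d
        ; enc   = λ d → if eqF d (car s) then false else enc s d
        ; phase = leaving }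
    leave-switch : ∀ d → phase s ≡ leaving → cand s d ≡ true → here s d ≡ true →
      Step s record s
        { car   = d
        ; par   = λ e → if eqF e d then just (car s) else par s e
        ; nb    = λ e x → if eqF e d then eqF x (car s) else nb s e x
        ; phase = visiting B' }
    leave-wait : ∀ d → phase s ≡ leaving → cand s d ≡ true →
      (∀ e → cand s e ≡ true → here s e ≡ false) →
      Step s record s { time = suc (time s) }
    leave-halt : phase s ≡ leaving → (∀ e → cand s e ≡ false) →
      par s (car s) ≡ nothing →
      Step s record s { phase = halted }
    leave-return : ∀ q → phase s ≡ leaving → (∀ e → cand s e ≡ false) →
      par s (car s) ≡ just q → here s q ≡ true →
      Step s record s { car = q }
    leave-wait-parent : ∀ q → phase s ≡ leaving → (∀ e → cand s e ≡ false) →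
      par s (car s) ≡ just q → here s q ≡ false →
      Step s record s { time = suc (time s) }

  initial : Fin k → State
  initial c0 = record
    { time  = 0
    ; car   = c0
    ; vis   = λ _ → false
    ; enc   = λ d → eqF d c0
    ; par   = λ _ → nothing
    ; nb    = λ _ _ → false
    ; phase = visiting B' }

  record Run (c0 : Fin k) : Set where
    field
      seq   : ℕ → State
      start : seq 0 ≡ initial c0
      next  : ∀ i → Step (seq i) (seq (suc i))
                    ⊎ (phase (seq i) ≡ halted × seq (suc i) ≡ seq i)

ridelength : Bool → ℕ → ℕ
ridelength toldHom B = if toldHom then B else B * B

module Submission where

-- If B ≥ p, any two carriers c, d have a common period
-- L ≤ B' (L = p(c) when the system is homogeneous, L = p(c)·p(d) ≤ B²
-- otherwise).  Hence two carriers that meet at all meet in every window of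
-- B' consecutive times, and a carrier passes every site of its route in
-- every such window.
--
-- We prove an invariant of the reachable states: Encounters and
-- Visited are disjoint, recorded neighbours and parents really meet their
-- carriers, every pending encounter hangs below the current carrier in the
-- parent tree, and the carriers met during the current B'-ride are all
-- Visited or Encountered.  By periodicity, once a carrier's ride is
-- finished, every carrier it ever meets is Visited or Encountered; so at
-- halting (Encounters empty) Visited is closed under meeting.  A second
-- invariant records that every site on the route of a Visited carrier has
-- already been occupied by the agent.  Feasibility then shows that every
-- site lies on the route of a carrier reachable from the Home by meetings,
-- hence is covered.
--
-- Each step lowers, lexicographically, (a) the number of
-- unvisited carriers (counted with the leaving flag), (b) the rank of the
-- current carrier in the parent tree, (c) the time still needed to reach
-- the next meeting or finish the ride, which by periodicity is below B'.

open import Defs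
open import Data.Nat hiding (_≟_)
open import Data.Nat.Properties hiding (_≟_)
open import Data.Nat.DivMod using ([m+kn]%n≡m%n)
open import Data.Fin using (Fin; _≟_)
open import Data.Fin.Properties using (fromℕ<-cong)
open import Data.Bool using (Bool; true; false; _∨_; _∧_; not; if_then_else_)
open import Data.Maybe using (Maybe; just; nothing)
open import Data.Maybe.Properties using (just-injective)
open import Data.Product using (_×_; _,_; ∃-syntax; proj₁; proj₂)
open import Data.Sum using (_⊎_; inj₁; inj₂)
open import Data.Empty using (⊥; ⊥-elim)
open import Relation.Binary.PropositionalEquality
open import Relation.Nullary using (yes; no; Dec; ¬_)
open import Relation.Nullary.Decidable using (isYes)
open import Data.List using ([]; _∷_; map; foldr; allFin)
open import Data.List.Membership.Propositional using (_∈_)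
open import Data.List.Membership.Propositional.Properties using (∈-map⁺; ∈-allFin)
import Data.List.Relation.Unary.Any as Any

shift-invariant-window : (P : ℕ → Set) (L : ℕ) → 1 ≤ L →
  (∀ t → P t → P (t + L)) → (∀ t → P (t + L) → P t) →
  ∀ {t₀} → P t₀ → ∀ a → ∃[ t ] (a ≤ t × t < a + L × P t)
shift-invariant-window P L L≥1 forward backward {t₀} pt₀ a =
  let (u , a≤u , pu) = beyond a in into-window (suc u) u ≤-refl a≤u pu
  where
    beyond : ∀ b → ∃[ u ] (b ≤ u × P u)
    beyond zero = t₀ , z≤n , pt₀
    beyond (suc b) with beyond b
    ... | u , b≤u , pu = u + L , subst (_≤ u + L) (+-comm b 1) (+-mono-≤ b≤u L≥1) , forward u pu

    -- shifting backward from u ≥ a lands in [a, a + L)  (fuel f > u)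
    into-window : ∀ f u → u < f → a ≤ u → P u → ∃[ t ] (a ≤ t × t < a + L × P t)
    into-window (suc f) u u<f a≤u pu with u <? a + L
    ... | yes u<a+L = u , a≤u , u<a+L , pu
    ... | no u≮a+L = into-window f (u ∸ L) u-L<f a≤u-L p[u-L]
      where
        a+L≤u : a + L ≤ u
        a+L≤u = ≮⇒≥ u≮a+L
        u-L+L≡u : u ∸ L + L ≡ u
        u-L+L≡u = m∸n+n≡m (m+n≤o⇒n≤o a a+L≤u)
        p[u-L] : P (u ∸ L)
        p[u-L] = backward (u ∸ L) (subst P (sym u-L+L≡u) pu)
        a≤u-L : a ≤ u ∸ L
        a≤u-L = subst (_≤ u ∸ L) (m+n∸n≡m a L) (∸-monoˡ-≤ L a+L≤u)
        u-L<f : u ∸ L < f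
        u-L<f = ≤-trans (subst (u ∸ L <_) u-L+L≡u (m<m+n (u ∸ L) L≥1)) (s≤s⁻¹ u<f)

Periodic : {A : Set} → (ℕ → A) → ℕ → Set
Periodic f L = ∀ t → f (t + L) ≡ f t

periodic-agreement-window : ∀ {A : Set} {f g : ℕ → A} {L} → 1 ≤ L →
  Periodic f L → Periodic g L →
  ∀ {t₀} → f t₀ ≡ g t₀ → ∀ a → ∃[ t ] (a ≤ t × t < a + L × f t ≡ g t)
periodic-agreement-window {f = f} {g} {L} L≥1 f-per g-per =
  shift-invariant-window (λ t → f t ≡ g t) L L≥1
    (λ t e → trans (f-per t) (trans e (sym (g-per t))))
    (λ t e → trans (sym (f-per t)) (trans e (g-per t)))

≤-foldr-⊔ : ∀ {x} xs → x ∈ xs → x ≤ foldr _⊔_ 0 xs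
≤-foldr-⊔ (y ∷ ys) (Any.here refl) = m≤m⊔n y (foldr _⊔_ 0 ys)
≤-foldr-⊔ (y ∷ ys) (Any.there x∈ys) = ≤-trans (≤-foldr-⊔ ys x∈ys) (m≤n⊔m y (foldr _⊔_ 0 ys))

module Periods {n k : ℕ} (G : PV n k) where
  open PV G

  π-periodic : ∀ c j → Periodic (π c) (j * period c)
  π-periodic c j t = cong (route c) (fromℕ<-cong _ _ ([m+kn]%n≡m%n t j (period c)) _ _)

  period≤sysPeriod : ∀ c → period c ≤ sysPeriod
  period≤sysPeriod c = ≤-foldr-⊔ (map period (allFin k)) (∈-map⁺ period (∈-allFin c))

  CommonPeriods : ℕ → Set
  CommonPeriods B' = ∀ c d → ∃[ L ] (1 ≤ L × L ≤ B' × Periodic (π c) L × Periodic (π d) L)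

  common-periods : ∀ B → sysPeriod ≤ B → (toldHom : Bool) → (toldHom ≡ true → Homogeneous) →
                   CommonPeriods (ridelength toldHom B)
  common-periods B p≤B true hom c d =
    period c , s≤s z≤n , ≤-trans (period≤sysPeriod c) p≤B , own-period c ,
    subst (Periodic (π d)) (hom refl d c) (own-period d)
    where
      own-period : ∀ c → Periodic (π c) (period c)
      own-period c = subst (Periodic (π c)) (*-identityˡ (period c)) (π-periodic c 1)
  common-periods B p≤B false hom c d =
    period c * period d , s≤s z≤n ,
    *-mono-≤ (≤-trans (period≤sysPeriod c) p≤B) (≤-trans (period≤sysPeriod d) p≤B) ,
    subst (Periodic (π c)) (*-comm (period d) (period c)) (π-periodic c (period d)) ,
    π-periodic d (period c)

  Meet : Fin k → Fin k → Set
  Meet c d = ∃[ t ] (π c t ≡ π d t)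

  module _ {B'} (common : CommonPeriods B') where

    meet-in-every-window : ∀ c d → Meet c d → ∀ a → ∃[ t ] (a ≤ t × t < a + B' × π c t ≡ π d t)
    meet-in-every-window c d (t₀ , e) a with common c d
    ... | L , L≥1 , L≤B' , c-per , d-per with periodic-agreement-window L≥1 c-per d-per {t₀} e a
    ...   | t , a≤t , t<a+L , e' = t , a≤t , <-≤-trans t<a+L (+-monoʳ-≤ a L≤B') , e'

    route-in-every-window : ∀ c t₀ a → ∃[ t ] (a ≤ t × t < a + B' × π c t ≡ π c t₀)
    route-in-every-window c t₀ a with common c c
    ... | L , L≥1 , L≤B' , c-per , _ with periodic-agreement-window {g = λ _ → π c t₀} L≥1 c-per (λ _ → refl) {t₀} refl a
    ...   | t , a≤t , t<a+L , e = t , a≤t , <-≤-trans t<a+L (+-monoʳ-≤ a L≤B') , e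

isYes-sound : ∀ {A : Set} (d : Dec A) → isYes d ≡ true → A
isYes-sound (yes a) _ = a
isYes-sound (no _) ()

isYes-complete : ∀ {A : Set} (d : Dec A) → A → isYes d ≡ true
isYes-complete (yes _) _ = refl
isYes-complete (no ¬a) a = ⊥-elim (¬a a)

isYes-false : ∀ {A : Set} (d : Dec A) → ¬ A → isYes d ≡ false
isYes-false (yes a) ¬a = ⊥-elim (¬a a)
isYes-false (no _) _ = refl

true≢false : true ≡ false → ⊥
true≢false ()

nothing≢just : ∀ {A : Set} {y : A} → nothing ≡ just y → ⊥
nothing≢just ()

∨-introˡ : ∀ {a b} → a ≡ true → a ∨ b ≡ true
∨-introˡ refl = refl

∨-introʳ : ∀ a {b} → b ≡ true → a ∨ b ≡ true
∨-introʳ true _ = refl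
∨-introʳ false b = b

∨-elim : ∀ a {b} → a ∨ b ≡ true → a ≡ true ⊎ b ≡ true
∨-elim true _ = inj₁ refl
∨-elim false b = inj₂ b

∨-resolve : ∀ a {b} → a ∨ b ≡ true → b ≡ false → a ≡ true
∨-resolve true _ _ = refl
∨-resolve false refl ()

∧-elim : ∀ a {b} → a ∧ b ≡ true → a ≡ true × b ≡ true
∧-elim true b = refl , b
∧-elim false ()

fresh-encounter : ∀ h v e → h ∧ not v ∧ not e ≡ true → h ≡ true × v ≡ false × e ≡ false
fresh-encounter true false false _ = refl , refl , refl
fresh-encounter true true e ()
fresh-encounter true false true ()
fresh-encounter false v e ()

seen-monotone : ∀ v e x → v ∨ e ≡ true → v ∨ (e ∨ x) ≡ true
seen-monotone true e x _ = refl
seen-monotone false true x _ = refl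
seen-monotone false false x ()

seen-if-present : ∀ h v e → h ≡ true → v ∨ (e ∨ (h ∧ not v ∧ not e)) ≡ true
seen-if-present h true e _ = refl
seen-if-present h false true _ = refl
seen-if-present true false false _ = refl

∸-suc : ∀ m r → suc r ≤ m → m ∸ r ≡ suc (m ∸ suc r)
∸-suc (suc m) zero _ = refl
∸-suc (suc m) (suc r) (s≤s r<m) = ∸-suc m r r<m

data Ancestor {k} (par : Fin k → Maybe (Fin k)) : Fin k → Fin k → Set where
  self : ∀ {x} → Ancestor par x x
  up   : ∀ {x y z} → par x ≡ just y → Ancestor par y z → Ancestor par x z

ancestor-transport : ∀ {k} (par par' : Fin k → Maybe (Fin k)) (d : Fin k) →
  (∀ y → ¬ y ≡ d → par' y ≡ par y) → (∀ y w → par y ≡ just w → ¬ w ≡ d) →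
  ∀ {x z} → ¬ x ≡ d → Ancestor par x z → Ancestor par' x z
ancestor-transport par par' d agree avoid x≢d self = self
ancestor-transport par par' d agree avoid {x} x≢d (up {y = y} p a) =
  up (trans (agree x x≢d) p) (ancestor-transport par par' d agree avoid (avoid x y p) a)

count : ∀ {m} → (Fin m → Bool) → ℕ
count {zero} f = 0
count {suc m} f = (if f Fin.zero then 1 else 0) + count (λ i → f (Fin.suc i))

count-mono : ∀ {m} (f g : Fin m → Bool) → (∀ d → g d ≡ true → f d ≡ true) → count g ≤ count f
count-mono {zero} f g g⊆f = z≤n
count-mono {suc m} f g g⊆f with g Fin.zero in g0 | f Fin.zero in f0
... | true  | true  = s≤s (count-mono _ _ (λ d → g⊆f (Fin.suc d)))
... | true  | false = ⊥-elim (true≢false (trans (sym (g⊆f Fin.zero g0)) f0))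
... | false | true  = m≤n⇒m≤1+n (count-mono _ _ (λ d → g⊆f (Fin.suc d)))
... | false | false = count-mono _ _ (λ d → g⊆f (Fin.suc d))

count-strict : ∀ {m} (f g : Fin m → Bool) → (∀ d → g d ≡ true → f d ≡ true) →
  ∀ c → g c ≡ false → f c ≡ true → count g < count f
count-strict {suc m} f g g⊆f Fin.zero gc fc rewrite gc | fc =
  s≤s (count-mono _ _ (λ d → g⊆f (Fin.suc d)))
count-strict {suc m} f g g⊆f (Fin.suc c) gc fc with g Fin.zero in g0 | f Fin.zero in f0
... | true  | true  = s≤s (count-strict _ _ (λ d → g⊆f (Fin.suc d)) c gc fc)
... | true  | false = ⊥-elim (true≢false (trans (sym (g⊆f Fin.zero g0)) f0))
... | false | true  = m≤n⇒m≤1+n (count-strict _ _ (λ d → g⊆f (Fin.suc d)) c gc fc)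
... | false | false = count-strict _ _ (λ d → g⊆f (Fin.suc d)) c gc fc

module Analysis {n k : ℕ} (G : PV n k) (B' : ℕ) (common : Periods.CommonPeriods G B')
                (c0 : Fin k) where
  open PV G
  open Periods G
  open HitchARide G B'

  eqF-refl : ∀ a → eqF a a ≡ true
  eqF-refl a = isYes-complete (a ≟ a) refl

  eqF-sound : ∀ a b → eqF a b ≡ true → a ≡ b
  eqF-sound a b = isYes-sound (a ≟ b)

  if-eq : ∀ {A : Set} a b {x y : A} → a ≡ b → (if eqF a b then x else y) ≡ x
  if-eq a .a refl rewrite eqF-refl a = refl

  if-neq : ∀ {A : Set} a b {x y : A} → ¬ a ≡ b → (if eqF a b then x else y) ≡ y
  if-neq a b a≢b rewrite isYes-false (a ≟ b) a≢b = refl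

  here-sound : ∀ s d → here s d ≡ true → π d (time s) ≡ pos s
  here-sound s d = isYes-sound (π d (time s) ≟ pos s)

  here-complete : ∀ s d → π d (time s) ≡ pos s → here s d ≡ true
  here-complete s d = isYes-complete (π d (time s) ≟ pos s)

  leaving≢visiting : ∀ {r} → leaving ≡ visiting r → ⊥
  leaving≢visiting ()

  Seen : State → Fin k → Set
  Seen s d = vis s d ∨ enc s d ≡ true

  record Invariant (s : State) : Set where
    field
      encountered-unvisited  : ∀ d → enc s d ≡ true → vis s d ≡ false
      leaving-car-visited    : phase s ≡ leaving → vis s (car s) ≡ true
      visiting-car-unvisited : ∀ r → phase s ≡ visiting r → vis s (car s) ≡ false
      parent-visited         : ∀ d q → par s d ≡ just q → vis s q ≡ true
      neighbour-meets        : ∀ c d → nb s c d ≡ true → Meet c d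
      parent-meets           : ∀ c q → par s c ≡ just q → Meet c q
      neighbour-seen         : ∀ c d → nb s c d ≡ true → Seen s d
      encounter-recorded     : ∀ d → enc s d ≡ true →
                               d ≡ car s ⊎ ∃[ c ] ((vis s c ≡ true ⊎ c ≡ car s) × nb s c d ≡ true)
      pending-on-stack       : ∀ c d → vis s c ≡ true → nb s c d ≡ true → enc s d ≡ true →
                               Ancestor (par s) (car s) c
      meeting-closed         : ∀ c d → vis s c ≡ true → Meet c d → Seen s d
      ride-window            : ∀ r → phase s ≡ visiting r → r ≤ B' × B' ∸ r ≤ time s ×
                               (∀ d t → time s ∸ (B' ∸ r) ≤ t → t < time s →
                                  π d t ≡ π (car s) t → Seen s d)
      halted-no-encounters   : phase s ≡ halted → ∀ d → enc s d ≡ false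
      home-seen              : Seen s c0

  _⊕_ : (Fin n → Set) → Fin n → Fin n → Set
  (K ⊕ y) z = K z ⊎ z ≡ y

  record Covered (K : Fin n → Set) (s : State) : Set where
    field
      visited-routes : ∀ c → vis s c ≡ true → ∀ t → K (π c t)
      current-ride   : ∀ r → phase s ≡ visiting r →
                       ∀ t → time s ∸ (B' ∸ r) ≤ t → t ≤ time s → K (π (car s) t)

  covered-mono : ∀ {K K' s} → (∀ y → K y → K' y) → Covered K s → Covered K' s
  covered-mono K⊆K' C = record
    { visited-routes = λ c vc t → K⊆K' _ (Covered.visited-routes C c vc t)
    ; current-ride   = λ r ph t lo hi → K⊆K' _ (Covered.current-ride C r ph t lo hi) }

  Preserved : State → State → Set₁
  Preserved s s' = Invariant s' × (∀ K → Covered K s → Covered (K ⊕ pos s') s')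

  module RideStep (s : State) (r : ℕ) (ph : phase s ≡ visiting (suc r)) (I : Invariant s) where
    open Invariant I

    fresh : Fin k → Bool
    fresh d = here s d ∧ not (vis s d) ∧ not (enc s d)

    after : State
    after = record s
      { time  = suc (time s)
      ; enc   = λ d → enc s d ∨ fresh d
      ; nb    = λ e d → if eqF e (car s) then nb s e d ∨ fresh d else nb s e d
      ; phase = visiting r }

    new-neighbour : ∀ c d → nb after c d ≡ true → nb s c d ≡ true ⊎ (c ≡ car s × fresh d ≡ true)
    new-neighbour c d h with c ≟ car s
    ... | no _ = inj₁ h
    ... | yes c≡car with ∨-elim (nb s c d) h
    ...   | inj₁ old = inj₁ old
    ...   | inj₂ new = inj₂ (c≡car , new)

    old-neighbour : ∀ c d → nb s c d ≡ true → nb after c d ≡ true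
    old-neighbour c d h with c ≟ car s
    ... | yes _ = ∨-introˡ h
    ... | no _ = h

    car-unvisited : vis s (car s) ≡ false
    car-unvisited = visiting-car-unvisited (suc r) ph

    seen-mono : ∀ d → Seen s d → Seen after d
    seen-mono d = seen-monotone (vis s d) (enc s d) (fresh d)

    encountered-unvisited′ : ∀ d → enc after d ≡ true → vis after d ≡ false
    encountered-unvisited′ d e' with ∨-elim (enc s d) e'
    ... | inj₁ e = encountered-unvisited d e
    ... | inj₂ f = proj₁ (proj₂ (fresh-encounter (here s d) (vis s d) (enc s d) f))

    neighbour-meets′ : ∀ c d → nb after c d ≡ true → Meet c d
    neighbour-meets′ c d h with new-neighbour c d h
    ... | inj₁ old = neighbour-meets c d old
    ... | inj₂ (refl , f) = time s , sym (here-sound s d (proj₁ (fresh-encounter (here s d) (vis s d) (enc s d) f)))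

    neighbour-seen′ : ∀ c d → nb after c d ≡ true → Seen after d
    neighbour-seen′ c d h with new-neighbour c d h
    ... | inj₁ old = seen-mono d (neighbour-seen c d old)
    ... | inj₂ (_ , f) = ∨-introʳ (vis s d) (∨-introʳ (enc s d) f)

    encounter-recorded′ : ∀ d → enc after d ≡ true →
      d ≡ car s ⊎ ∃[ c ] ((vis s c ≡ true ⊎ c ≡ car s) × nb after c d ≡ true)
    encounter-recorded′ d e' with ∨-elim (enc s d) e'
    ... | inj₂ f = inj₂ (car s , inj₂ refl , trans (if-eq (car s) (car s) refl) (∨-introʳ (nb s (car s) d) f))
    ... | inj₁ e with encounter-recorded d e
    ...   | inj₁ d≡car = inj₁ d≡car
    ...   | inj₂ (c , vc , h) = inj₂ (c , vc , old-neighbour c d h)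

    -- a visited c is not car, so its pending neighbours were already pending
    pending-on-stack′ : ∀ c d → vis s c ≡ true → nb after c d ≡ true → enc after d ≡ true →
                        Ancestor (par s) (car s) c
    pending-on-stack′ c d vc h e' with new-neighbour c d h
    ... | inj₂ (refl , _) = ⊥-elim (true≢false (trans (sym vc) car-unvisited))
    ... | inj₁ old with ∨-elim (enc s d) e'
    ...   | inj₁ e = pending-on-stack c d vc old e
    ...   | inj₂ f with fresh-encounter (here s d) (vis s d) (enc s d) f | neighbour-seen c d old
    ...     | _ , v≡f , e≡f | seen rewrite v≡f | e≡f = ⊥-elim (true≢false (sym seen))

    ride-window′ : ∀ r' → visiting r ≡ visiting r' → r' ≤ B' × B' ∸ r' ≤ suc (time s) ×
      (∀ d t → suc (time s) ∸ (B' ∸ r') ≤ t → t < suc (time s) → π d t ≡ π (car s) t → Seen after d)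
    ride-window′ .r refl with ride-window (suc r) ph
    ... | r<B' , started , window =
      <⇒≤ r<B' , subst (_≤ suc (time s)) (sym (∸-suc B' r r<B')) (s≤s started) , window′
      where
        window′ : ∀ d t → suc (time s) ∸ (B' ∸ r) ≤ t → t < suc (time s) → π d t ≡ π (car s) t → Seen after d
        window′ d t lo hi meet rewrite ∸-suc B' r r<B' with m≤n⇒m<n∨m≡n (s≤s⁻¹ hi)
        ... | inj₁ t<now = seen-mono d (window d t lo t<now meet)
        ... | inj₂ refl = seen-if-present (here s d) (vis s d) (enc s d) (here-complete s d meet)

    preserved : Preserved s after
    preserved = invariant , coverage
      where
        invariant : Invariant after
        invariant = record
          { encountered-unvisited  = encountered-unvisited′
          ; leaving-car-visited    = λ ()
          ; visiting-car-unvisited = λ _ _ → car-unvisited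
          ; parent-visited         = parent-visited
          ; neighbour-meets        = neighbour-meets′
          ; parent-meets           = parent-meets
          ; neighbour-seen         = neighbour-seen′
          ; encounter-recorded     = encounter-recorded′
          ; pending-on-stack       = pending-on-stack′
          ; meeting-closed         = λ c d vc m → seen-mono d (meeting-closed c d vc m)
          ; ride-window            = ride-window′
          ; halted-no-encounters   = λ ()
          ; home-seen              = seen-mono c0 home-seen }

        coverage : ∀ K → Covered K s → Covered (K ⊕ pos after) after
        coverage K C = record
          { visited-routes = λ c vc t → inj₁ (Covered.visited-routes C c vc t)
          ; current-ride   = current-ride′ }
          where
            current-ride′ : ∀ r' → visiting r ≡ visiting r' → ∀ t → suc (time s) ∸ (B' ∸ r') ≤ t →
                            t ≤ suc (time s) → (K ⊕ pos after) (π (car s) t)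
            current-ride′ .r refl t lo hi with m≤n⇒m<n∨m≡n hi
            ... | inj₂ refl = inj₂ refl
            ... | inj₁ t≤now rewrite ∸-suc B' r (proj₁ (ride-window (suc r) ph)) =
              inj₁ (Covered.current-ride C (suc r) ph t lo (s≤s⁻¹ t≤now))

  -- visit-done: the B'-ride is over; car becomes Visited.  By periodicity
  -- the ride window [time ∸ B', time) already contains every meeting of car
  -- and every site of its route.
  module FinishVisit (s : State) (ph : phase s ≡ visiting 0) (I : Invariant s) where
    open Invariant I

    after : State
    after = record s
      { vis   = λ d → if eqF d (car s) then true  else vis s d
      ; enc   = λ d → if eqF d (car s) then false else enc s d
      ; phase = leaving }

    visited-mono : ∀ d → vis s d ≡ true → vis after d ≡ true
    visited-mono d h with d ≟ car s
    ... | yes _ = refl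
    ... | no _ = h

    car-visited : vis after (car s) ≡ true
    car-visited = if-eq (car s) (car s) refl

    car-unvisited-before : vis s (car s) ≡ false
    car-unvisited-before = visiting-car-unvisited 0 ph

    encounter-before : ∀ d → enc after d ≡ true → ¬ d ≡ car s × enc s d ≡ true
    encounter-before d h with d ≟ car s
    ... | yes _ = ⊥-elim (true≢false (sym h))
    ... | no d≢car = d≢car , h

    seen-mono : ∀ d → Seen s d → Seen after d
    seen-mono d h with d ≟ car s
    ... | yes _ = refl
    ... | no _ = h

    ride-start : time s ∸ B' + B' ≡ time s
    ride-start = m∸n+n≡m (proj₁ (proj₂ (ride-window 0 ph)))

    ride-seen : ∀ d t → time s ∸ B' ≤ t → t < time s → π d t ≡ π (car s) t → Seen s d
    ride-seen = proj₂ (proj₂ (ride-window 0 ph))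

    meeting-closed′ : ∀ c d → vis after c ≡ true → Meet c d → Seen after d
    meeting-closed′ c d vc m with c ≟ car s
    ... | no _ = seen-mono d (meeting-closed c d vc m)
    ... | yes refl with meet-in-every-window common (car s) d m (time s ∸ B')
    ...   | t , lo , hi , meet =
            seen-mono d (ride-seen d t lo (subst (t <_) ride-start hi) (sym meet))

    pending-on-stack′ : ∀ c d → vis after c ≡ true → nb s c d ≡ true → enc after d ≡ true →
                        Ancestor (par s) (car s) c
    pending-on-stack′ c d vc h e' with c ≟ car s
    ... | yes refl = self
    ... | no _ = pending-on-stack c d vc h (proj₂ (encounter-before d e'))

    encounter-recorded′ : ∀ d → enc after d ≡ true →
      d ≡ car s ⊎ ∃[ c ] ((vis after c ≡ true ⊎ c ≡ car s) × nb s c d ≡ true)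
    encounter-recorded′ d e' with encounter-before d e'
    ... | d≢car , e with encounter-recorded d e
    ...   | inj₁ d≡car = ⊥-elim (d≢car d≡car)
    ...   | inj₂ (c , inj₁ vc , h) = inj₂ (c , inj₁ (visited-mono c vc) , h)
    ...   | inj₂ (c , inj₂ refl , h) = inj₂ (c , inj₁ car-visited , h)

    preserved : Preserved s after
    preserved = invariant , coverage
      where
        invariant : Invariant after
        invariant = record
          { encountered-unvisited  = λ d e' → let (d≢car , e) = encounter-before d e'
                                              in trans (if-neq d (car s) d≢car) (encountered-unvisited d e)
          ; leaving-car-visited    = λ _ → car-visited
          ; visiting-car-unvisited = λ _ ()
          ; parent-visited         = λ d q h → visited-mono q (parent-visited d q h)
          ; neighbour-meets        = neighbour-meets
          ; parent-meets           = parent-meets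
          ; neighbour-seen         = λ c d h → seen-mono d (neighbour-seen c d h)
          ; encounter-recorded     = encounter-recorded′
          ; pending-on-stack       = pending-on-stack′
          ; meeting-closed         = meeting-closed′
          ; ride-window            = λ _ ()
          ; halted-no-encounters   = λ ()
          ; home-seen              = seen-mono c0 home-seen }

        -- the whole route of car was occupied during the ride
        visited-routes′ : ∀ K → Covered K s → ∀ c → vis after c ≡ true → ∀ t → (K ⊕ pos after) (π c t)
        visited-routes′ K C c vc t with c ≟ car s
        ... | no _ = inj₁ (Covered.visited-routes C c vc t)
        ... | yes refl with route-in-every-window common (car s) t (time s ∸ B')
        ...   | t' , lo , hi , e =
                inj₁ (subst K e (Covered.current-ride C 0 ph t' lo (<⇒≤ (subst (t' <_) ride-start hi))))

        coverage : ∀ K → Covered K s → Covered (K ⊕ pos after) after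
        coverage K C = record { visited-routes = visited-routes′ K C ; current-ride = λ _ () }

  visited-or-car : ∀ s {c} → vis s (car s) ≡ true → (vis s c ≡ true ⊎ c ≡ car s) → vis s c ≡ true
  visited-or-car s _ (inj₁ vc) = vc
  visited-or-car s v (inj₂ refl) = v

  module SwitchTo (s : State) (d0 : Fin k) (ph : phase s ≡ leaving) (cd : cand s d0 ≡ true)
                  (hd : here s d0 ≡ true) (I : Invariant s) where
    open Invariant I

    after : State
    after = record s
      { car   = d0
      ; par   = λ e → if eqF e d0 then just (car s) else par s e
      ; nb    = λ e x → if eqF e d0 then eqF x (car s) else nb s e x
      ; phase = visiting B' }

    car-visited : vis s (car s) ≡ true
    car-visited = leaving-car-visited ph

    d0-unvisited : vis s d0 ≡ false
    d0-unvisited = encountered-unvisited d0 (proj₂ (∧-elim (nb s (car s) d0) cd))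

    visited≢d0 : ∀ c → vis s c ≡ true → ¬ c ≡ d0
    visited≢d0 c vc refl = true≢false (trans (sym vc) d0-unvisited)

    d0-meets-car : Meet d0 (car s)
    d0-meets-car = time s , here-sound s d0 hd

    parent-visited′ : ∀ e q → par after e ≡ just q → vis s q ≡ true
    parent-visited′ e q h with e ≟ d0
    ... | yes _ = subst (λ x → vis s x ≡ true) (just-injective h) car-visited
    ... | no _ = parent-visited e q h

    neighbour-meets′ : ∀ c x → nb after c x ≡ true → Meet c x
    neighbour-meets′ c x h with c ≟ d0
    ... | yes refl = subst (Meet d0) (sym (eqF-sound x (car s) h)) d0-meets-car
    ... | no _ = neighbour-meets c x h

    parent-meets′ : ∀ c q → par after c ≡ just q → Meet c q
    parent-meets′ c q h with c ≟ d0
    ... | yes refl = subst (Meet d0) (just-injective h) d0-meets-car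
    ... | no _ = parent-meets c q h

    neighbour-seen′ : ∀ c x → nb after c x ≡ true → Seen s x
    neighbour-seen′ c x h with c ≟ d0
    ... | yes refl = ∨-introˡ (subst (λ y → vis s y ≡ true) (sym (eqF-sound x (car s) h)) car-visited)
    ... | no _ = neighbour-seen c x h

    encounter-recorded′ : ∀ x → enc s x ≡ true →
      x ≡ d0 ⊎ ∃[ c ] ((vis s c ≡ true ⊎ c ≡ d0) × nb after c x ≡ true)
    encounter-recorded′ x e with x ≟ d0
    ... | yes x≡d0 = inj₁ x≡d0
    ... | no _ with encounter-recorded x e
    ...   | inj₁ refl = ⊥-elim (true≢false (trans (sym car-visited) (encountered-unvisited x e)))
    ...   | inj₂ (c , vc , h) =
            let vc′ = visited-or-car s car-visited vc
            in inj₂ (c , inj₁ vc′ , trans (if-neq c d0 (visited≢d0 c vc′)) h)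

    -- the path from car to c stays valid below the new child d0
    pending-on-stack′ : ∀ c x → vis s c ≡ true → nb after c x ≡ true → enc s x ≡ true →
                        Ancestor (par after) d0 c
    pending-on-stack′ c x vc h e with c ≟ d0
    ... | yes c≡d0 = ⊥-elim (visited≢d0 c vc c≡d0)
    ... | no _ = up (if-eq d0 d0 refl)
                    (ancestor-transport (par s) (par after) d0 (λ y y≢d0 → if-neq y d0 y≢d0)
                       (λ y w h' → visited≢d0 w (parent-visited y w h'))
                       (visited≢d0 (car s) car-visited) (pending-on-stack c x vc h e))

    -- the new ride has not started: its window is empty
    ride-window′ : ∀ r → visiting B' ≡ visiting r → r ≤ B' × B' ∸ r ≤ time s ×
      (∀ d t → time s ∸ (B' ∸ r) ≤ t → t < time s → π d t ≡ π d0 t → Seen s d)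
    ride-window′ .B' refl = ≤-refl , subst (_≤ time s) (sym (n∸n≡0 B')) z≤n , empty
      where
        empty : ∀ d t → time s ∸ (B' ∸ B') ≤ t → t < time s → π d t ≡ π d0 t → Seen s d
        empty d t lo hi _ rewrite n∸n≡0 B' = ⊥-elim (<-irrefl refl (≤-<-trans lo hi))

    preserved : Preserved s after
    preserved = invariant , coverage
      where
        invariant : Invariant after
        invariant = record
          { encountered-unvisited  = encountered-unvisited
          ; leaving-car-visited    = λ ()
          ; visiting-car-unvisited = λ _ _ → d0-unvisited
          ; parent-visited         = parent-visited′
          ; neighbour-meets        = neighbour-meets′
          ; parent-meets           = parent-meets′
          ; neighbour-seen         = neighbour-seen′
          ; encounter-recorded     = encounter-recorded′
          ; pending-on-stack       = pending-on-stack′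
          ; meeting-closed         = meeting-closed
          ; ride-window            = ride-window′
          ; halted-no-encounters   = λ ()
          ; home-seen              = home-seen }

        coverage : ∀ K → Covered K s → Covered (K ⊕ pos after) after
        coverage K C = record
          { visited-routes = λ c vc t → inj₁ (Covered.visited-routes C c vc t)
          ; current-ride   = current-ride′ }
          where
            current-ride′ : ∀ r → visiting B' ≡ visiting r → ∀ t → time s ∸ (B' ∸ r) ≤ t →
                            t ≤ time s → (K ⊕ pos after) (π d0 t)
            current-ride′ .B' refl t lo hi rewrite n∸n≡0 B' with ≤-antisym lo hi
            ... | refl = inj₂ refl

  module Wait (s : State) (ph : phase s ≡ leaving) (I : Invariant s) where
    open Invariant I

    after : State
    after = record s { time = suc (time s) }

    preserved : Preserved s after
    preserved = invariant , coverage
      where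
        invariant : Invariant after
        invariant = record
          { encountered-unvisited  = encountered-unvisited
          ; leaving-car-visited    = leaving-car-visited
          ; visiting-car-unvisited = visiting-car-unvisited
          ; parent-visited         = parent-visited
          ; neighbour-meets        = neighbour-meets
          ; parent-meets           = parent-meets
          ; neighbour-seen         = neighbour-seen
          ; encounter-recorded     = encounter-recorded
          ; pending-on-stack       = pending-on-stack
          ; meeting-closed         = meeting-closed
          ; ride-window            = λ r h → ⊥-elim (leaving≢visiting (trans (sym ph) h))
          ; halted-no-encounters   = halted-no-encounters
          ; home-seen              = home-seen }

        coverage : ∀ K → Covered K s → Covered (K ⊕ pos after) after
        coverage K C = record
          { visited-routes = λ c vc t → inj₁ (Covered.visited-routes C c vc t)
          ; current-ride   = λ r h → ⊥-elim (leaving≢visiting (trans (sym ph) h)) }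

  pending-above-car : ∀ s → Invariant s → phase s ≡ leaving → (∀ e → cand s e ≡ false) →
    ∀ c x → vis s c ≡ true → nb s c x ≡ true → enc s x ≡ true →
    ∃[ y ] (par s (car s) ≡ just y × Ancestor (par s) y c)
  pending-above-car s I ph none c x vc h e with Invariant.pending-on-stack I c x vc h e
  ... | self = ⊥-elim (true≢false (trans (sym (cong₂ _∧_ h e)) (none x)))
  ... | up {y = y} p a = y , p , a

  module HaltStep (s : State) (ph : phase s ≡ leaving) (none : ∀ e → cand s e ≡ false)
                  (home : par s (car s) ≡ nothing) (I : Invariant s) where
    open Invariant I

    after : State
    after = record s { phase = halted }

    car-visited : vis s (car s) ≡ true
    car-visited = leaving-car-visited ph

    no-encounters : ∀ d → enc s d ≡ false
    no-encounters d with enc s d in e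
    ... | false = refl
    ... | true with encounter-recorded d e
    ...   | inj₁ refl = ⊥-elim (true≢false (trans (sym car-visited) (encountered-unvisited d e)))
    ...   | inj₂ (c , vc , h) with pending-above-car s I ph none c d (visited-or-car s car-visited vc) h e
    ...     | _ , p , _ = ⊥-elim (nothing≢just (trans (sym home) p))

    preserved : Preserved s after
    preserved = invariant , coverage
      where
        invariant : Invariant after
        invariant = record
          { encountered-unvisited  = encountered-unvisited
          ; leaving-car-visited    = λ ()
          ; visiting-car-unvisited = λ _ ()
          ; parent-visited         = parent-visited
          ; neighbour-meets        = neighbour-meets
          ; parent-meets           = parent-meets
          ; neighbour-seen         = neighbour-seen
          ; encounter-recorded     = encounter-recorded
          ; pending-on-stack       = pending-on-stack
          ; meeting-closed         = meeting-closed
          ; ride-window            = λ _ ()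
          ; halted-no-encounters   = λ _ → no-encounters
          ; home-seen              = home-seen }

        coverage : ∀ K → Covered K s → Covered (K ⊕ pos after) after
        coverage K C = record
          { visited-routes = λ c vc t → inj₁ (Covered.visited-routes C c vc t)
          ; current-ride   = λ _ () }

  module ReturnToParent (s : State) (q : Fin k) (ph : phase s ≡ leaving)
                        (none : ∀ e → cand s e ≡ false) (pq : par s (car s) ≡ just q)
                        (I : Invariant s) where
    open Invariant I

    after : State
    after = record s { car = q }

    car-visited : vis s (car s) ≡ true
    car-visited = leaving-car-visited ph

    encounter-recorded′ : ∀ x → enc s x ≡ true →
      x ≡ q ⊎ ∃[ c ] ((vis s c ≡ true ⊎ c ≡ q) × nb s c x ≡ true)
    encounter-recorded′ x e with encounter-recorded x e
    ... | inj₁ refl = ⊥-elim (true≢false (trans (sym car-visited) (encountered-unvisited x e)))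
    ... | inj₂ (c , inj₁ vc , h) = inj₂ (c , inj₁ vc , h)
    ... | inj₂ (c , inj₂ refl , h) = inj₂ (c , inj₁ car-visited , h)

    pending-on-stack′ : ∀ c x → vis s c ≡ true → nb s c x ≡ true → enc s x ≡ true → Ancestor (par s) q c
    pending-on-stack′ c x vc h e with pending-above-car s I ph none c x vc h e
    ... | y , p , a = subst (λ z → Ancestor (par s) z c) (just-injective (trans (sym p) pq)) a

    preserved : Preserved s after
    preserved = invariant , coverage
      where
        invariant : Invariant after
        invariant = record
          { encountered-unvisited  = encountered-unvisited
          ; leaving-car-visited    = λ _ → parent-visited (car s) q pq
          ; visiting-car-unvisited = λ r h → ⊥-elim (leaving≢visiting (trans (sym ph) h))
          ; parent-visited         = parent-visited
          ; neighbour-meets        = neighbour-meets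
          ; parent-meets           = parent-meets
          ; neighbour-seen         = neighbour-seen
          ; encounter-recorded     = encounter-recorded′
          ; pending-on-stack       = pending-on-stack′
          ; meeting-closed         = meeting-closed
          ; ride-window            = λ r h → ⊥-elim (leaving≢visiting (trans (sym ph) h))
          ; halted-no-encounters   = halted-no-encounters
          ; home-seen              = home-seen }

        coverage : ∀ K → Covered K s → Covered (K ⊕ pos after) after
        coverage K C = record
          { visited-routes = λ c vc t → inj₁ (Covered.visited-routes C c vc t)
          ; current-ride   = λ r h → ⊥-elim (leaving≢visiting (trans (sym ph) h)) }

  step-preserves : ∀ {s s'} → Step s s' → Invariant s → Preserved s s'
  step-preserves {s} (visit-ride r ph)                    = RideStep.preserved s r ph
  step-preserves {s} (visit-done ph)                      = FinishVisit.preserved s ph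
  step-preserves {s} (leave-switch d ph cd hd)            = SwitchTo.preserved s d ph cd hd
  step-preserves {s} (leave-wait _ ph _ _)                = Wait.preserved s ph
  step-preserves {s} (leave-halt ph none home)            = HaltStep.preserved s ph none home
  step-preserves {s} (leave-return q ph none pq _)        = ReturnToParent.preserved s q ph none pq
  step-preserves {s} (leave-wait-parent _ ph _ _ _)       = Wait.preserved s ph

  initial-invariant : Invariant (initial c0)
  initial-invariant = record
    { encountered-unvisited  = λ _ _ → refl
    ; leaving-car-visited    = λ ()
    ; visiting-car-unvisited = λ _ _ → refl
    ; parent-visited         = λ _ _ ()
    ; neighbour-meets        = λ _ _ ()
    ; parent-meets           = λ _ _ ()
    ; neighbour-seen         = λ _ _ ()
    ; encounter-recorded     = λ d h → inj₁ (eqF-sound d c0 h)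
    ; pending-on-stack       = λ _ _ ()
    ; meeting-closed         = λ _ _ ()
    ; ride-window            = ride-window₀
    ; halted-no-encounters   = λ ()
    ; home-seen              = eqF-refl c0 }
    where
      ride-window₀ : ∀ r → visiting B' ≡ visiting r → r ≤ B' × B' ∸ r ≤ 0 ×
        (∀ d t → 0 ∸ (B' ∸ r) ≤ t → t < 0 → π d t ≡ π c0 t → Seen (initial c0) d)
      ride-window₀ .B' refl = ≤-refl , subst (_≤ 0) (sym (n∸n≡0 B')) z≤n , λ _ _ _ ()

  initial-covered : ∀ {K} → K (π c0 0) → Covered K (initial c0)
  initial-covered {K} k = record { visited-routes = λ _ () ; current-ride = current-ride₀ }
    where
      current-ride₀ : ∀ r → visiting B' ≡ visiting r → ∀ t → 0 ∸ (B' ∸ r) ≤ t → t ≤ 0 → K (π c0 t)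
      current-ride₀ _ _ zero _ _ = k

  -- Potential for liveness: finishing a visit lowers it by one (one fewer
  -- unvisited carrier, counted twice, against the leaving flag), switching
  -- to a child lowers it by one; no other step raises it.
  leaving-flag : Phase → ℕ
  leaving-flag leaving = 1
  leaving-flag _ = 0

  unvisited : State → ℕ
  unvisited s = count (λ d → not (vis s d))

  potential : State → ℕ
  potential s = leaving-flag (phase s) + (unvisited s + unvisited s)

  finish-lowers-potential : ∀ s ph I → potential (FinishVisit.after s ph I) < potential s
  finish-lowers-potential s ph I rewrite ph =
    subst (_≤ unvisited s + unvisited s) (cong suc (+-suc a' a')) (+-mono-≤ fewer fewer)
    where
      a' = unvisited (FinishVisit.after s ph I)
      unvisited-before : ∀ d → not (vis (FinishVisit.after s ph I) d) ≡ true → not (vis s d) ≡ true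
      unvisited-before d h with d ≟ car s
      ... | yes _ = ⊥-elim (true≢false (sym h))
      ... | no _ = h
      fewer : a' < unvisited s
      fewer = count-strict (λ d → not (vis s d)) (λ d → not (vis (FinishVisit.after s ph I) d))
                unvisited-before (car s) (cong not (FinishVisit.car-visited s ph I))
                (cong not (FinishVisit.car-unvisited-before s ph I))

  switch-lowers-potential : ∀ s d ph cd hd I → potential (SwitchTo.after s d ph cd hd I) < potential s
  switch-lowers-potential s d ph cd hd I rewrite ph = ≤-refl

  RanksParents : State → (Fin k → ℕ) → Set
  RanksParents s rk = ∀ d q → par s d ≡ just q → rk q < rk d

  switch-rank : ∀ s d ph cd hd I (rk : Fin k → ℕ) → RanksParents s rk →
    RanksParents (SwitchTo.after s d ph cd hd I) (λ e → if eqF e d then suc (rk (car s)) else rk e)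
  switch-rank s d ph cd hd I rk ranked e q h with e ≟ d
  ... | yes refl = subst (λ x → rank′ x < suc (rk (car s))) (just-injective h)
                     (subst (_< suc (rk (car s))) (sym (if-neq (car s) d (visited≢d0 (car s) car-visited))) ≤-refl)
    where
      open SwitchTo s d ph cd hd I using (visited≢d0; car-visited)
      rank′ : Fin k → ℕ
      rank′ x = if eqF x d then suc (rk (car s)) else rk x
  ... | no _ = subst (_< rk e) (sym (if-neq q d (visited≢d0 q (Invariant.parent-visited I e q h)))) (ranked e q h)
    where open SwitchTo s d ph cd hd I using (visited≢d0)

  Target : State → Fin k → Set
  Target s d = cand s d ≡ true ⊎ ((∀ e → cand s e ≡ false) × par s (car s) ≡ just d)

  WaitBound : State → ℕ → Set
  WaitBound s w = (∀ r → phase s ≡ visiting r → r < w) ×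
    (phase s ≡ leaving → ∀ d → Target s d → ∃[ t ] (time s ≤ t × t < time s + w × π d t ≡ π (car s) t))

  -- Targets meet the current carrier, hence do so within B' time units.
  leaving-wait-bound : ∀ s → Invariant s → phase s ≡ leaving → WaitBound s B'
  leaving-wait-bound s I ph = (λ r h → ⊥-elim (leaving≢visiting (trans (sym ph) h))) , bound
    where
      target-meets : ∀ d → Target s d → Meet (car s) d
      target-meets d (inj₁ c) = Invariant.neighbour-meets I (car s) d (proj₁ (∧-elim (nb s (car s) d) c))
      target-meets d (inj₂ (_ , p)) = Invariant.parent-meets I (car s) d p
      bound : phase s ≡ leaving → ∀ d → Target s d → ∃[ t ] (time s ≤ t × t < time s + B' × π d t ≡ π (car s) t)
      bound _ d target with meet-in-every-window common (car s) d (target-meets d target) (time s)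
      ... | t , lo , hi , e = t , lo , hi , sym e

  wait-bound-step : ∀ s w → phase s ≡ leaving → WaitBound s (suc w) →
    (∀ d → Target s d → here s d ≡ false) → WaitBound (record s { time = suc (time s) }) w
  wait-bound-step s w ph (_ , bound) absent = (λ r h → ⊥-elim (leaving≢visiting (trans (sym ph) h))) , bound′
    where
      bound′ : phase s ≡ leaving → ∀ d → Target s d →
               ∃[ t ] (suc (time s) ≤ t × t < suc (time s) + w × π d t ≡ π (car s) t)
      bound′ _ d target with bound ph d target
      ... | t , lo , hi , e with m≤n⇒m<n∨m≡n lo
      ...   | inj₁ later = t , later , subst (t <_) (+-suc (time s) w) hi , e
      ...   | inj₂ refl = ⊥-elim (true≢false (trans (sym (here-complete s d e)) (absent d target)))

  no-wait-left : ∀ s → phase s ≡ leaving → ∀ d → Target s d → WaitBound s 0 → ⊥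
  no-wait-left s ph d target (_ , bound) with bound ph d target
  ... | t , lo , hi , _ = <-irrefl refl (<-≤-trans hi (subst (_≤ t) (sym (+-identityʳ (time s))) lo))

  record Budget (N m w : ℕ) (s : State) : Set where
    field
      rank        : Fin k → ℕ
      ranked      : RanksParents s rank
      potential<N : potential s < N
      rank<m      : rank (car s) < m
      wait        : WaitBound s w

  module Execution (run : Run c0) where
    open Run run

    Occupied : ℕ → Fin n → Set
    Occupied i y = ∃[ j ] (j ≤ i × pos (seq j) ≡ y)

    occupied-mono : ∀ i y → Occupied i y → Occupied (suc i) y
    occupied-mono i y (j , j≤i , e) = j , m≤n⇒m≤1+n j≤i , e

    reachable : ∀ i → Invariant (seq i) × Covered (Occupied i) (seq i)
    reachable zero = subst (λ s → Invariant s × Covered (Occupied 0) s) (sym start)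
                       (initial-invariant , initial-covered (0 , z≤n , cong pos start))
    reachable (suc i) with reachable i | next i
    ... | I , C | inj₁ step = proj₁ (step-preserves step I) ,
                              covered-mono occupied-now (proj₂ (step-preserves step I) (Occupied i) C)
      where
        occupied-now : ∀ y → (Occupied i ⊕ pos (seq (suc i))) y → Occupied (suc i) y
        occupied-now y (inj₁ o) = occupied-mono i y o
        occupied-now y (inj₂ refl) = suc i , ≤-refl , refl
    ... | I , C | inj₂ (_ , stays) = subst (λ s → Invariant s × Covered (Occupied (suc i)) s) (sym stays)
                                       (I , covered-mono (occupied-mono i) C)

    invariant : ∀ i → Invariant (seq i)
    invariant i = proj₁ (reachable i)

    visiting-potential : ∀ s {r} → phase s ≡ visiting r → potential s ≡ unvisited s + unvisited s
    visiting-potential s ph rewrite ph = refl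

    transport : ∀ {N m w i s'} → seq (suc i) ≡ s' → Budget N m w s' → Budget N m w (seq (suc i))
    transport moved = subst (Budget _ _ _) (sym moved)

    -- Descent on (N, m, w) lexicographically: each step either halts or
    -- continues with a smaller budget.
    mutual
      halts-from : ∀ N m w i → Budget N m w (seq i) → ∃[ T ] (phase (seq T) ≡ halted)
      halts-from N m w i b with next i
      ... | inj₂ (halted-now , _) = i , halted-now
      ... | inj₁ step = after-step N m w i b _ step refl

      after-step : ∀ N m w i → Budget N m w (seq i) → ∀ s' → Step (seq i) s' → seq (suc i) ≡ s' →
                   ∃[ T ] (phase (seq T) ≡ halted)
      after-step zero m w i b _ _ _ = ⊥-elim (n≮0 (Budget.potential<N b))
      after-step N zero w i b _ _ _ = ⊥-elim (n≮0 (Budget.rank<m b))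
      after-step N m zero i b _ (visit-ride r ph) _ = ⊥-elim (n≮0 (proj₁ (Budget.wait b) (suc r) ph))
      after-step N m (suc w) i b _ (visit-ride r ph) moved =
        halts-from N m w (suc i) (transport moved record
          { rank        = rank
          ; ranked      = ranked
          ; potential<N = subst (_< N) (visiting-potential (seq i) ph) potential<N
          ; rank<m      = rank<m
          ; wait        = (λ { _ refl → s≤s⁻¹ (proj₁ wait (suc r) ph) }) , λ () })
        where open Budget b
      after-step (suc N) m w i b _ (visit-done ph) moved =
        halts-from N (suc (rank (car (seq i)))) B' (suc i) (transport moved record
          { rank        = rank
          ; ranked      = ranked
          ; potential<N = <-≤-trans (finish-lowers-potential (seq i) ph I) (s≤s⁻¹ potential<N)
          ; rank<m      = ≤-refl
          ; wait        = leaving-wait-bound _ (proj₁ (FinishVisit.preserved (seq i) ph I)) refl })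
        where
          I = invariant i
          open Budget b
      after-step (suc N) m w i b _ (leave-switch d ph cd hd) moved =
        halts-from N (suc (rank′ d)) (suc B') (suc i) (transport moved record
          { rank        = rank′
          ; ranked      = switch-rank (seq i) d ph cd hd I rank ranked
          ; potential<N = <-≤-trans (switch-lowers-potential (seq i) d ph cd hd I) (s≤s⁻¹ potential<N)
          ; rank<m      = ≤-refl
          ; wait        = (λ { _ refl → ≤-refl }) , λ () })
        where
          I = invariant i
          open Budget b
          rank′ : Fin k → ℕ
          rank′ e = if eqF e d then suc (rank (car (seq i))) else rank e
      after-step N m zero i b _ (leave-wait d ph cd _) _ =
        ⊥-elim (no-wait-left (seq i) ph d (inj₁ cd) (Budget.wait b))
      after-step N m (suc w) i b _ (leave-wait d ph cd absent) moved =
        halts-from N m w (suc i) (transport moved record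
          { rank        = rank
          ; ranked      = ranked
          ; potential<N = potential<N
          ; rank<m      = rank<m
          ; wait        = wait-bound-step (seq i) w ph wait targets-absent })
        where
          open Budget b
          targets-absent : ∀ d' → Target (seq i) d' → here (seq i) d' ≡ false
          targets-absent d' (inj₁ c) = absent d' c
          targets-absent d' (inj₂ (none , _)) = ⊥-elim (true≢false (trans (sym cd) (none d)))
      after-step N m zero i b _ (leave-wait-parent q ph none pq _) _ =
        ⊥-elim (no-wait-left (seq i) ph q (inj₂ (none , pq)) (Budget.wait b))
      after-step N m (suc w) i b _ (leave-wait-parent q ph none pq absent) moved =
        halts-from N m w (suc i) (transport moved record
          { rank        = rank
          ; ranked      = ranked
          ; potential<N = potential<N
          ; rank<m      = rank<m
          ; wait        = wait-bound-step (seq i) w ph wait targets-absent })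
        where
          open Budget b
          targets-absent : ∀ d' → Target (seq i) d' → here (seq i) d' ≡ false
          targets-absent d' (inj₁ c) = ⊥-elim (true≢false (trans (sym c) (none d')))
          targets-absent d' (inj₂ (_ , p)) =
            subst (λ x → here (seq i) x ≡ false) (just-injective (trans (sym pq) p)) absent
      after-step N m w i b _ (leave-halt _ _ _) moved =
        suc i , subst (λ x → phase x ≡ halted) (sym moved) refl
      after-step N (suc m) w i b _ (leave-return q ph none pq _) moved =
        halts-from N m B' (suc i) (transport moved record
          { rank        = rank
          ; ranked      = ranked
          ; potential<N = potential<N
          ; rank<m      = <-≤-trans (ranked (car (seq i)) q pq) (s≤s⁻¹ rank<m)
          ; wait        = leaving-wait-bound _ (proj₁ (ReturnToParent.preserved (seq i) q ph none pq I)) ph })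
        where
          I = invariant i
          open Budget b

    halts : ∃[ T ] (phase (seq T) ≡ halted)
    halts = halts-from (suc (potential (initial c0))) 1 (suc B') 0
              (subst (Budget _ 1 (suc B')) (sym start) initial-budget)
      where
        initial-budget : Budget (suc (potential (initial c0))) 1 (suc B') (initial c0)
        initial-budget = record
          { rank        = λ _ → 0
          ; ranked      = λ _ _ p → ⊥-elim (nothing≢just p)
          ; potential<N = ≤-refl
          ; rank<m      = s≤s z≤n
          ; wait        = (λ { _ refl → ≤-refl }) , λ () }

    -- When the agent has halted, Visited is closed under meeting and contains
    -- the Home, so feasibility puts every site on a visited route.
    module AtHalt (T : ℕ) (halted-at : phase (seq T) ≡ halted) where
      open Invariant (invariant T)

      seen⇒visited : ∀ d → Seen (seq T) d → vis (seq T) d ≡ true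
      seen⇒visited d h = ∨-resolve (vis (seq T) d) h (halted-no-encounters halted-at d)

      moves-stay-on-visited-routes : ∀ t x cs → ∃[ c ] (vis (seq T) c ≡ true × π c t ≡ x) →
        ValidMoves t x cs → ∀ y → y ∈ visitedSites t x cs →
        ∃[ c ] ∃[ t' ] (vis (seq T) c ≡ true × π c t' ≡ y)
      moves-stay-on-visited-routes t x [] (c , vc , e) _ y (Any.here refl) = c , t , vc , e
      moves-stay-on-visited-routes t x (_ ∷ _) (c , vc , e) _ y (Any.here refl) = c , t , vc , e
      moves-stay-on-visited-routes t x (c' ∷ cs) (c , vc , e) (c'-here , valid) y (Any.there y∈) =
        moves-stay-on-visited-routes (suc t) (π c' (suc t)) cs
          (c' , seen⇒visited c' (meeting-closed c c' vc (t , trans e (sym c'-here))) , refl) valid y y∈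

      all-sites-occupied : Feasible → ∀ y → Occupied T y
      all-sites-occupied feasible y with feasible (π c0 0) (c0 , refl)
      ... | cs , valid , covers
        with moves-stay-on-visited-routes 0 (π c0 0) cs (c0 , seen⇒visited c0 home-seen , refl) valid y (covers y)
      ...   | c , t , vc , e with Covered.visited-routes (proj₂ (reachable T)) c vc t
      ...     | j , j≤T , pj = j , j≤T , trans pj e

theorem9 : ∀ {n k} (G : PV n k) → PV.Feasible G →
    (B : ℕ) → PV.sysPeriod G ≤ B →
    (toldHom : Bool) → (toldHom ≡ true → PV.Homogeneous G) →
    (c0 : Fin k) → (run : HitchARide.Run G (ridelength toldHom B) c0) →
    let open HitchARide G (ridelength toldHom B) in
    ∃[ T ] (phase (Run.seq run T) ≡ halted
           × (∀ (y : Fin n) → ∃[ i ] (i ≤ T × pos (Run.seq run i) ≡ y)))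
theorem9 G feasible B p≤B toldHom hom c0 run =
  let open Analysis G (ridelength toldHom B) (Periods.common-periods G B p≤B toldHom hom) c0
      open Execution run
      (T , halted-at) = halts
  in T , halted-at , AtHalt.all-sites-occupied T halted-at feasible
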